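{- For every integer $k\geq 0$, the $k$-th order tripod $T_k=(E_k,G_k)$ has dimension $3k+1$. Moreover, for every $k\geq 1$ there is a flat $F_k$ of $G_k$ of dimension $2k+2$ such that $(E_k\cap F_k, F_k)\cong C_{5,2k+2}$ and $F_k\subseteq E_k\cup (E_k+E_k)$.
   Context: A (simple binary) matroid is a pair $M=(E,G)$ where $G$ is a finite binary projective geometry $\mathrm{PG}(n-1,2)$, identified with the set of nonzero vectors of $\mathrm{GF}(2)^n$, and $E$ is any subset of the points of $G$; $n$ is the dimension of $M$. A flat of $G$ is the set of nonzero vectors of a linear subspace, with the subspace's dimension; $\mathrm{cl}(S)$ denotes the smallest flat containing $S$. Matroids $(E_1,G_1)$, $(E_2,G_2)$ are isomorphic if some isomorphism $G_1\to G_2$ of projective geometries maps $E_1$ onto $E_2$. For sets of vectors, $A+B=\{a+b: a\in A, b\in B\}$. Tripods: $T_0$ is the $1$-dimensional matroid with a one-element ground set. For $k\ge 1$, $T_k=(E_k,G_k)$ is a matroid for which there are a flat $H$ of $G_k$ of codimension $3$ and points $x,y,z\notin H$ with $\mathrm{cl}(H\cup\{x,y,z\})=G_k$, such that $E_k=(H\cap E_k)\cup(\{x,y,z\}+(H\cap E_k))\cup\{x+y+z\}$ and $(E_k\cap H, H)\cong T_{k-1}$. $C_5$ is the $4$-dimensional matroid whose ground set consists of five points of $\mathrm{PG}(3,2)$ spanning it and summing to zero. For $t\ge 4$, $C_{5,t}$ is the $t$-dimensional matroid $(E,G)$ such that $(E,\mathrm{cl}(E))\cong C_5$ (so $C_{5,4}\cong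 C_5$). -}

module Defs where

open import Data.Bool using (Bool; true; false; _xor_)
open import Data.Nat using (ℕ; zero; suc; _+_; _*_)
open import Data.Vec using (Vec; []; _∷_; zipWith; replicate)
open import Data.Product using (Σ; ∃; ∃-syntax; _×_; _,_)
open import Data.Sum using (_⊎_)
open import Data.List using (List; []; _∷_)
open import Data.List.Relation.Unary.All using (All)
open import Relation.Nullary using (¬_)
open import Relation.Binary.PropositionalEquality using (_≡_; refl; sym; trans; cong; subst)
open import Function.Bundles using (_⇔_)

V : ℕ → Set
V n = Vec Bool n

𝟎 : ∀ {n} → V n
𝟎 {n} = replicate n false

infixl 6 _⊕_
_⊕_ : ∀ {n} → V n → V n → V n
_⊕_ = zipWith _xor_

_·_ : ∀ {n} → Bool → V n → V n
true  · v = v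
false · v = 𝟎

sumV : ∀ {n} → List (V n) → V n
sumV []       = 𝟎
sumV (v ∷ vs) = v ⊕ sumV vs

⊕-self : ∀ {n} (v : V n) → v ⊕ v ≡ 𝟎
⊕-self []           = refl
⊕-self (true ∷ v)   = cong (false ∷_) (⊕-self v)
⊕-self (false ∷ v)  = cong (false ∷_) (⊕-self v)

-- A (simple binary) matroid of dimension n: a subset E of the points
-- (nonzero vectors) of PG(n-1,2) = GF(2)^n ∖ {0}.

record Matroid (n : ℕ) : Set₁ where
  field
    E    : V n → Set
    E-nz : ∀ v → E v → ¬ (v ≡ 𝟎)
open Matroid public

-- A flat of dimension d of PG(n-1,2), presented by an injective linear
-- map φ : GF(2)^d → GF(2)^n; the flat is the set of nonzero vectors of
-- the image of φ (a d-dimensional subspace), which φ identifies with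
-- PG(d-1,2).
record Flat (n d : ℕ) : Set where
  field
    φ     : V d → V n
    φ-add : ∀ u w → φ (u ⊕ w) ≡ φ u ⊕ φ w
    φ-inj : ∀ u w → φ u ≡ φ w → u ≡ w
open Flat public

_∈F_ : ∀ {n d} → V n → Flat n d → Set
v ∈F F = ∃[ u ] (φ F u ≡ v)

φ-zero : ∀ {n d} (F : Flat n d) → φ F 𝟎 ≡ 𝟎
φ-zero F =
  trans (cong (φ F) (sym (⊕-self 𝟎)))
        (trans (φ-add F 𝟎 𝟎) (⊕-self (φ F 𝟎)))

-- The restriction (E ∩ F, F) of a matroid to a flat F, viewed as a
-- matroid on PG(d-1,2) via the identification φ.
restrict : ∀ {n d} → Matroid n → Flat n d → Matroid d
restrict M F = record
  { E    = λ u → E M (φ F u)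
  ; E-nz = λ u e u≡0 → E-nz M (φ F u) e (trans (cong (φ F) u≡0) (φ-zero F)) }

-- v lies in the linear span of the set S (i.e. v ∈ cl(S) ∪ {0})
InSpan : ∀ {n} → (V n → Set) → V n → Set
InSpan S v = ∃[ vs ] (All S vs × sumV vs ≡ v)

Distinct5 : ∀ {n} → V n → V n → V n → V n → V n → Set
Distinct5 a b c d e =
  ¬ a ≡ b × ¬ a ≡ c × ¬ a ≡ d × ¬ a ≡ e ×
  ¬ b ≡ c × ¬ b ≡ d × ¬ b ≡ e ×
  ¬ c ≡ d × ¬ c ≡ e ×
  ¬ d ≡ e

IsC5 : ∀ {n} → Matroid n → Set
IsC5 {n} M =
  n ≡ 4 ×
  Σ (V n) λ a → Σ (V n) λ b → Σ (V n) λ c → Σ (V n) λ d → Σ (V n) λ e →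
    Distinct5 a b c d e ×
    (∀ v → E M v ⇔ (v ≡ a ⊎ v ≡ b ⊎ v ≡ c ⊎ v ≡ d ⊎ v ≡ e)) ×
    (a ⊕ b ⊕ c ⊕ d ⊕ e ≡ 𝟎) ×
    (∀ v → InSpan (E M) v)

-- C_{5,t}: the t-dimensional matroid (E,G) (t ≥ 4) with (E, cl(E)) ≅ C5.
-- Here cl(E) is given as a flat F with E ⊆ F ⊆ span(E).
IsC5t : (t : ℕ) → Matroid t → Set
IsC5t t M =
  Σ ℕ λ d → Σ (Flat t d) λ F →
    (∀ v → E M v → v ∈F F) ×
    (∀ u → InSpan (E M) (φ F u)) ×
    IsC5 (restrict M F)

-- Tripods.  IsTripod k M means "M is (isomorphic to) T_k".

IsTripod : ℕ → ∀ {n} → Matroid n → Set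
IsTripod zero {n} M =
  (n ≡ 1) × Σ (V n) λ p → (∀ v → E M v ⇔ (v ≡ p))
IsTripod (suc k) {n} M =
  Σ ℕ λ d → (d + 3 ≡ n) × Σ (Flat n d) λ H →
  Σ (V n) λ x → Σ (V n) λ y → Σ (V n) λ z →
    ¬ (x ∈F H) × ¬ (y ∈F H) × ¬ (z ∈F H) ×
    -- cl(H ∪ {x,y,z}) = G
    (∀ v → Σ (V d) λ u → Σ Bool λ a → Σ Bool λ b → Σ Bool λ c →
             v ≡ φ H u ⊕ a · x ⊕ b · y ⊕ c · z) ×
    (∀ v → E M v ⇔
       ((v ∈F H × E M v)
        ⊎ (Σ (V d) λ u → E M (φ H u) ×
             (v ≡ x ⊕ φ H u ⊎ v ≡ y ⊕ φ H u ⊎ v ≡ z ⊕ φ H u))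
        ⊎ v ≡ x ⊕ y ⊕ z)) ×
    IsTripod k (restrict M H)

{-# OPTIONS --safe #-}
module Submission where

-- Write GF(2)^n = H ⊕ ⟨x, y, z⟩ for the data (H, x, y, z) of T_{k+1}: x, y, z are independent
-- modulo H because a linear map of GF(2)^m onto GF(2)^m is injective, by counting. In these
-- coordinates T_{k+1} consists of the points (0, u), (e_i, u) for u ∈ T_k, and (1, 1, 1, 0).
-- F_1 is all of GF(2)^4, where T_1 = {h, x+h, y+h, z+h, x+y+z} is a C₅, and
-- F_{k+1} = F_k ⊕ ⟨x+y, y+z⟩. Points of F_{k+1} have coordinates of even weight, so F_{k+1}
-- meets T_{k+1} only in F_k ∩ T_k; and a point (e_i + e_j, u) of F_{k+1} is (e_i, a) + (e_j, b)
-- if u = a + b with a, b ∈ T_k, (1, 1, 1, 0) + (e_l, u) if u ∈ T_k, and (e_i, p) + (e_j, p) for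
-- any p ∈ T_k if u = 0.

open import Defs
open import Algebra.Bundles using (AbelianGroup; CommutativeRing)
import Algebra.Properties.CommutativeSemigroup as CommutativeSemigroupProperties
import Algebra.Properties.Group as GroupProperties
import Algebra.Solver.CommutativeMonoid as CommutativeMonoidSolver
open import Data.Bool using (Bool; true; false; _xor_)
open import Data.Bool.Properties
  using (xor-assoc; xor-comm; xor-identityˡ; xor-identityʳ; xor-∧-commutativeRing)
  renaming (_≟_ to _≟ᵇ_)
open import Data.Empty using (⊥-elim)
open import Data.Fin using (Fin; zero; suc; combine; quotient; remainder)
open import Data.Fin.Properties using (combine-injective; combine-remQuot; injective⇒≤)
open import Data.List using (List; []; _∷_; _++_; map)
open import Data.List.Relation.Unary.All using ([]; _∷_) renaming (map to All-map)
import Data.List.Relation.Unary.All.Properties as All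
open import Data.Nat using (ℕ; zero; suc; _+_; _*_; _^_; _≤_; _≥_; s≤s; z≤n)
open import Data.Nat.Properties
  using (+-comm; *-suc; ≤-reflexive; ≤-trans; ≮⇒≥; <⇒≱; ^-monoʳ-<; 1+n≰n)
open import Data.Product using (Σ; _×_; _,_; proj₁; proj₂)
open import Data.Sum using (_⊎_; inj₁; inj₂)
open import Data.Vec using (Vec; []; _∷_) renaming (_++_ to _++ᵥ_)
open import Data.Vec.Properties
  using ( zipWith-assoc; zipWith-comm; zipWith-identityˡ; zipWith-identityʳ; zipWith-++
        ; ∷-injective; ∷-injectiveʳ; ≡-dec)
open import Function using (_∘_)
open import Function.Bundles using (_⇔_; mk⇔; Equivalence)
open import Function.Definitions using (Injective)
import Function.Properties.Equivalence as ⇔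
open import Level using (0ℓ)
open import Relation.Nullary using (¬_; yes; no)
open import Relation.Binary.PropositionalEquality
open Equivalence using (to; from)

private variable
  k d m n t : ℕ

private
  pattern O = false
  pattern I = true

⊕-abelianGroup : ℕ → AbelianGroup 0ℓ 0ℓ
⊕-abelianGroup n = record
  { Carrier = V n
  ; _≈_ = _≡_
  ; _∙_ = _⊕_
  ; ε = 𝟎
  ; _⁻¹ = λ v → v
  ; isAbelianGroup = record
    { isGroup = record
      { isMonoid = record
        { isSemigroup = record
          { isMagma = record { isEquivalence = isEquivalence ; ∙-cong = cong₂ _⊕_ }
          ; assoc = zipWith-assoc xor-assoc }
        ; identity = zipWith-identityˡ xor-identityˡ , zipWith-identityʳ xor-identityʳ }
      ; inverse = ⊕-self , ⊕-self
      ; ⁻¹-cong = λ u≡v → u≡v }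
    ; comm = zipWith-comm xor-comm } }

module ⊕-Properties {n : ℕ} where
  open AbelianGroup (⊕-abelianGroup n) public
    using () renaming (assoc to ⊕-assoc; identityˡ to ⊕-identityˡ; identityʳ to ⊕-identityʳ)
  open GroupProperties (AbelianGroup.group (⊕-abelianGroup n)) public
    using () renaming (∙-cancelˡ to ⊕-cancelˡ; x∙y⁻¹≈ε⇒x≈y to ⊕≡𝟎⇒≡)
open ⊕-Properties

module ⊕-Solver {n : ℕ} = CommutativeMonoidSolver (AbelianGroup.commutativeMonoid (⊕-abelianGroup n))
  using (solve; _⊜_; id) renaming (_⊕_ to infixl 6 _⊞_)

·-distrib-xor : ∀ a b (v : V n) → (a xor b) · v ≡ a · v ⊕ b · v
·-distrib-xor false false v = sym (⊕-identityˡ 𝟎)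
·-distrib-xor false true  v = sym (⊕-identityˡ v)
·-distrib-xor true  false v = sym (⊕-identityʳ v)
·-distrib-xor true  true  v = sym (⊕-self v)

-- Linear maps and flats

Linear : (V m → V n) → Set
Linear f = ∀ u w → f (u ⊕ w) ≡ f u ⊕ f w

linear-𝟎 : {f : V m → V n} → Linear f → f 𝟎 ≡ 𝟎
linear-𝟎 {f = f} f-linear =
  trans (cong f (sym (⊕-self 𝟎))) (trans (f-linear 𝟎 𝟎) (⊕-self (f 𝟎)))

kernel⇒injective : {f : V m → V n} → Linear f → (∀ v → f v ≡ 𝟎 → v ≡ 𝟎) →
                   ∀ u w → f u ≡ f w → u ≡ w
kernel⇒injective {f = f} f-linear f-kernel u w fu≡fw = ⊕≡𝟎⇒≡ u w (f-kernel (u ⊕ w) (begin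
  f (u ⊕ w)   ≡⟨ f-linear u w ⟩
  f u ⊕ f w   ≡⟨ cong (_⊕ f w) fu≡fw ⟩
  f w ⊕ f w   ≡⟨ ⊕-self (f w) ⟩
  𝟎           ∎))
  where open ≡-Reasoning

_∘ᶠ_ : Flat n d → Flat d m → Flat n m
K ∘ᶠ F = record
  { φ = φ K ∘ φ F
  ; φ-add = λ u w → trans (cong (φ K) (φ-add F u w)) (φ-add K (φ F u) (φ F w))
  ; φ-inj = λ u w eq → φ-inj F u w (φ-inj K (φ F u) (φ F w) eq) }

idᶠ : Flat n n
idᶠ = record { φ = λ v → v ; φ-add = λ _ _ → refl ; φ-inj = λ _ _ eq → eq }

sumV-image : (K : Flat n m) (us : List (V m)) → φ K (sumV us) ≡ sumV (map (φ K) us)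
sumV-image K []       = φ-zero K
sumV-image K (u ∷ us) = trans (φ-add K u (sumV us)) (cong (φ K u ⊕_) (sumV-image K us))

sumV-++ : (us ws : List (V n)) → sumV (us ++ ws) ≡ sumV us ⊕ sumV ws
sumV-++ []       ws = sym (⊕-identityˡ (sumV ws))
sumV-++ (u ∷ us) ws = trans (cong (u ⊕_) (sumV-++ us ws)) (sym (⊕-assoc u (sumV us) (sumV ws)))

module _ {P : V n → Set} where

  InSpan-𝟎 : InSpan P 𝟎
  InSpan-𝟎 = [] , [] , refl

  InSpan-∈ : ∀ {v} → P v → InSpan P v
  InSpan-∈ {v} v∈P = v ∷ [] , v∈P ∷ [] , ⊕-identityʳ v

  InSpan-⊕ : ∀ {v w} → InSpan P v → InSpan P w → InSpan P (v ⊕ w)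
  InSpan-⊕ (us , us⊆P , refl) (ws , ws⊆P , refl) =
    us ++ ws , All.++⁺ us⊆P ws⊆P , sumV-++ us ws

  InSpan-mono : ∀ {Q : V n → Set} {v} → (∀ {w} → P w → Q w) → InSpan P v → InSpan Q v
  InSpan-mono P⊆Q (us , us⊆P , sum≡v) = us , All-map P⊆Q us⊆P , sum≡v

InSpan-image : ∀ {P : V n → Set} (K : Flat n m) {u} → InSpan (P ∘ φ K) u → InSpan P (φ K u)
InSpan-image K (us , us⊆P , refl) = map (φ K) us , All.map⁺ us⊆P , sym (sumV-image K us)

-- Counting

bit : Bool → Fin 2
bit false = zero
bit true  = suc zero

unbit : Fin 2 → Bool
unbit zero    = false
unbit (suc _) = true

bits : V m → Fin (2 ^ m)
bits []      = zero
bits (b ∷ v) = combine (bit b) (bits v)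

unbits : Fin (2 ^ m) → V m
unbits {zero}  _ = []
unbits {suc m} i = unbit (quotient (2 ^ m) i) ∷ unbits (remainder {2} (2 ^ m) i)

bits-unbits : ∀ m (i : Fin (2 ^ m)) → bits (unbits {m} i) ≡ i
bits-unbits zero    zero = refl
bits-unbits (suc m) i = begin
  combine (bit (unbit q)) (bits (unbits {m} r))  ≡⟨ cong₂ combine (bit-unbit q) (bits-unbits m r) ⟩
  combine q r                                    ≡⟨ combine-remQuot {2} (2 ^ m) i ⟩
  i                                              ∎
  where
  open ≡-Reasoning
  q = quotient (2 ^ m) i
  r = remainder {2} (2 ^ m) i
  bit-unbit : ∀ j → bit (unbit j) ≡ j
  bit-unbit zero       = refl
  bit-unbit (suc zero) = refl

bits-injective : ∀ (u w : V m) → bits u ≡ bits w → u ≡ w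
bits-injective []      []      _  = refl
bits-injective (a ∷ u) (b ∷ w) eq with combine-injective (bit a) (bits u) (bit b) (bits w) eq
... | a≡b , u≡w = cong₂ _∷_ (bit-injective a b a≡b) (bits-injective u w u≡w)
  where
  bit-injective : ∀ a b → bit a ≡ bit b → a ≡ b
  bit-injective false false _ = refl
  bit-injective true  true  _ = refl
  bit-injective false true  ()
  bit-injective true  false ()

V-injective⇒≤ : {f : V m → V n} → Injective _≡_ _≡_ f → m ≤ n
V-injective⇒≤ {m} {n} {f} f-injective = ≮⇒≥ λ n<m →
  <⇒≱ (^-monoʳ-< 2 (s≤s (s≤s z≤n)) n<m) (injective⇒≤ code-injective)
  where
  code : Fin (2 ^ m) → Fin (2 ^ n)
  code = bits ∘ f ∘ unbits
  code-injective : Injective _≡_ _≡_ code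
  code-injective {i} {j} eq = begin
    i                    ≡⟨ sym (bits-unbits m i) ⟩
    bits (unbits {m} i)  ≡⟨ cong bits (f-injective (bits-injective _ _ eq)) ⟩
    bits (unbits {m} j)  ≡⟨ bits-unbits m j ⟩
    j                    ∎
    where open ≡-Reasoning

-- If f k = 𝟎 with k ≠ 𝟎, then (b ∷ v) ↦ g v ⊕ b · k embeds V (suc n) into V m.
linear-onto⇒injective : {f : V m → V n} (g : V n → V m) → m ≤ n → Linear f →
                        (∀ v → f (g v) ≡ v) → ∀ u w → f u ≡ f w → u ≡ w
linear-onto⇒injective {m} {n} {f} g m≤n f-linear f∘g≡id =
  kernel⇒injective f-linear kernel-trivial
  where
  kernel-trivial : ∀ k → f k ≡ 𝟎 → k ≡ 𝟎
  kernel-trivial k fk≡𝟎 with ≡-dec _≟ᵇ_ k 𝟎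
  ... | yes k≡𝟎 = k≡𝟎
  ... | no  k≢𝟎 = ⊥-elim (1+n≰n (≤-trans (V-injective⇒≤ h-injective) m≤n))
    where
    h : V (suc n) → V m
    h (b ∷ v) = g v ⊕ b · k

    f-b·k : ∀ b → f (b · k) ≡ 𝟎
    f-b·k false = linear-𝟎 f-linear
    f-b·k true  = fk≡𝟎

    f∘h : ∀ b v → f (h (b ∷ v)) ≡ v
    f∘h b v = trans (f-linear (g v) (b · k))
                    (trans (cong₂ _⊕_ (f∘g≡id v) (f-b·k b)) (⊕-identityʳ v))

    b·k-injective : ∀ a b → a · k ≡ b · k → a ≡ b
    b·k-injective false false _   = refl
    b·k-injective true  true  _   = refl
    b·k-injective false true  eq  = ⊥-elim (k≢𝟎 (sym eq))
    b·k-injective true  false eq  = ⊥-elim (k≢𝟎 eq)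

    h-injective : Injective _≡_ _≡_ h
    h-injective {a ∷ u} {b ∷ w} eq with trans (sym (f∘h a u)) (trans (cong f eq) (f∘h b w))
    ... | refl = cong (_∷ u) (b·k-injective a b (⊕-cancelˡ (g u) (a · k) (b · k) eq))

-- Restrictions and C₅ flats

IsC5-resp : {A B : Matroid n} → (∀ v → E A v ⇔ E B v) → IsC5 A → IsC5 B
IsC5-resp A⇔B (dim , a , b , c , d , e , distinct , ground , sum , spans) =
  dim , a , b , c , d , e , distinct , (λ v → ⇔.trans (⇔.sym (A⇔B v)) (ground v)) , sum ,
  (λ v → InSpan-mono (to (A⇔B _)) (spans v))

IsC5t-resp : {A B : Matroid t} → (∀ v → E A v ⇔ E B v) → IsC5t t A → IsC5t t B
IsC5t-resp {A = A} {B} A⇔B (d , F , E⊆F , F⊆span , c5) =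
  d , F , (λ v e → E⊆F v (from (A⇔B v) e)) , (λ u → InSpan-mono (to (A⇔B _)) (F⊆span u)) ,
  IsC5-resp {A = restrict A F} {restrict B F} (λ u → A⇔B (φ F u)) c5

IsC5t-lift : {M : Matroid n} (K : Flat n m) → (∀ v → E M v → v ∈F K) →
             IsC5t m (restrict M K) → IsC5t n M
IsC5t-lift {M = M} K E⊆K (d , G , E⊆G , G⊆span , c5) =
  d , K ∘ᶠ G , E⊆KG , (λ u → InSpan-image K (G⊆span u)) , c5
  where
  E⊆KG : ∀ v → E M v → v ∈F (K ∘ᶠ G)
  E⊆KG v e with E⊆K v e
  ... | u , refl with E⊆G u e
  ... | w , refl = w , refl

PairSum : (V n → Set) → V n → Set
PairSum {n} P v = Σ (V n) λ a → Σ (V n) λ b → P a × P b × v ≡ a ⊕ b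

Covers : Matroid n → Flat n m → Set
Covers M F = ∀ u → ¬ (u ≡ 𝟎) → E M (φ F u) ⊎ PairSum (E M) (φ F u)

C5Flat : ℕ → Matroid n → Set
C5Flat {n} m M = Σ (Flat n m) λ F → IsC5t m (restrict M F) × Covers M F

covers-span : {M : Matroid n} → Covers M idᶠ → ∀ v → InSpan (E M) v
covers-span covers v with ≡-dec _≟ᵇ_ v 𝟎
... | yes refl = InSpan-𝟎
... | no  v≢𝟎 with covers v v≢𝟎
... | inj₁ v∈E = InSpan-∈ v∈E
... | inj₂ (a , b , a∈E , b∈E , refl) = InSpan-⊕ (InSpan-∈ a∈E) (InSpan-∈ b∈E)

Covers-∘ : {M : Matroid n} (K : Flat n d) (F : Flat d m) →
           Covers (restrict M K) F → Covers M (K ∘ᶠ F)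
Covers-∘ K F covers u u≢𝟎 with covers u u≢𝟎
... | inj₁ e = inj₁ e
... | inj₂ (a , b , a∈E , b∈E , eq) =
  inj₂ (φ K a , φ K b , a∈E , b∈E , trans (cong (φ K) eq) (φ-add K a b))

restrict-C5Flat : {M : Matroid n} (K : Flat n d) → C5Flat m (restrict M K) → C5Flat m M
restrict-C5Flat {M = M} K (F , c5 , covers) = K ∘ᶠ F , c5 , Covers-∘ {M = M} K F covers

-- Tripods in coordinates

-- A vector (a ∷ b ∷ c ∷ u) stands for φ H u ⊕ a · x ⊕ b · y ⊕ c · z (see coordinateMap).
data TripodGround {d} (P : V d → Set) : V (3 + d) → Set where
  in-H  : ∀ {u} → P u → TripodGround P (O ∷ O ∷ O ∷ u)
  x+H   : ∀ {u} → P u → TripodGround P (I ∷ O ∷ O ∷ u)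
  y+H   : ∀ {u} → P u → TripodGround P (O ∷ I ∷ O ∷ u)
  z+H   : ∀ {u} → P u → TripodGround P (O ∷ O ∷ I ∷ u)
  x+y+z : TripodGround P (I ∷ I ∷ I ∷ 𝟎)

module _ {P : V d → Set} where

  TripodGround-map : ∀ {Q : V d → Set} → (∀ {u} → P u → Q u) →
                     ∀ {v} → TripodGround P v → TripodGround Q v
  TripodGround-map P⊆Q (in-H p) = in-H (P⊆Q p)
  TripodGround-map P⊆Q (x+H p)  = x+H (P⊆Q p)
  TripodGround-map P⊆Q (y+H p)  = y+H (P⊆Q p)
  TripodGround-map P⊆Q (z+H p)  = z+H (P⊆Q p)
  TripodGround-map P⊆Q x+y+z    = x+y+z

  in-H⁻¹ : ∀ {u} → TripodGround P (O ∷ O ∷ O ∷ u) → P u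
  in-H⁻¹ (in-H p) = p

  even-weight : ∀ s t {u} → TripodGround P (s ∷ (s xor t) ∷ t ∷ u) → s ≡ O × t ≡ O
  even-weight O O _  = refl , refl
  even-weight O I ()
  even-weight I O ()
  even-weight I I ()

TripodGround-resp : ∀ {P Q : V d → Set} → (∀ u → P u ⇔ Q u) →
                    ∀ v → TripodGround P v ⇔ TripodGround Q v
TripodGround-resp P⇔Q v = mk⇔ (TripodGround-map (to (P⇔Q _))) (TripodGround-map (from (P⇔Q _)))

coordinateMap : Flat n d → (x y z : V n) → V (3 + d) → V n
coordinateMap H x y z (a ∷ b ∷ c ∷ u) = φ H u ⊕ a · x ⊕ b · y ⊕ c · z

coordinateMap-linear : (H : Flat n d) (x y z : V n) → Linear (coordinateMap H x y z)
coordinateMap-linear {n} H x y z (a ∷ b ∷ c ∷ u) (a' ∷ b' ∷ c' ∷ u') = begin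
  φ H (u ⊕ u') ⊕ (a xor a') · x ⊕ (b xor b') · y ⊕ (c xor c') · z
    ≡⟨ cong₂ _⊕_ (cong₂ _⊕_ (cong₂ _⊕_ (φ-add H u u') (·-distrib-xor a a' x))
                            (·-distrib-xor b b' y))
                 (·-distrib-xor c c' z) ⟩
  φ H u ⊕ φ H u' ⊕ (a · x ⊕ a' · x) ⊕ (b · y ⊕ b' · y) ⊕ (c · z ⊕ c' · z)
    ≡⟨ solve 8 (λ h h' p p' q q' r r' →
                  h ⊞ h' ⊞ (p ⊞ p') ⊞ (q ⊞ q') ⊞ (r ⊞ r') ⊜
                  (h ⊞ p ⊞ q ⊞ r) ⊞ (h' ⊞ p' ⊞ q' ⊞ r'))
               refl (φ H u) (φ H u') (a · x) (a' · x) (b · y) (b' · y) (c · z) (c' · z) ⟩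
  (φ H u ⊕ a · x ⊕ b · y ⊕ c · z) ⊕ (φ H u' ⊕ a' · x ⊕ b' · y ⊕ c' · z) ∎
  where
  open ≡-Reasoning
  open ⊕-Solver {n}

Spans : Flat n d → (x y z : V n) → Set
Spans {n} {d} H x y z = ∀ v → Σ (V d) λ u → Σ Bool λ a → Σ Bool λ b → Σ Bool λ c →
                          v ≡ φ H u ⊕ a · x ⊕ b · y ⊕ c · z

coordinateFlat : (H : Flat n d) (x y z : V n) → d + 3 ≡ n → Spans H x y z → Flat n (3 + d)
coordinateFlat {d = d} H x y z d+3≡n spans = record
  { φ = coordinateMap H x y z
  ; φ-add = coordinateMap-linear H x y z
  ; φ-inj = linear-onto⇒injective (proj₁ ∘ preimage) (≤-reflexive (trans (+-comm 3 d) d+3≡n))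
                                  (coordinateMap-linear H x y z) (proj₂ ∘ preimage) }
  where
  preimage : ∀ v → Σ (V (3 + d)) λ c → coordinateMap H x y z c ≡ v
  preimage v with spans v
  ... | u , a , b , c , v≡ = a ∷ b ∷ c ∷ u , sym v≡

module CoordinateMap {n d} (H : Flat n d) (x y z : V n) where
  open ⊕-Solver {n}

  coordinateMap-H : ∀ u → coordinateMap H x y z (O ∷ O ∷ O ∷ u) ≡ φ H u
  coordinateMap-H u = solve 1 (λ h → h ⊞ id ⊞ id ⊞ id ⊜ h) refl (φ H u)

  coordinateMap-x+H : ∀ u → coordinateMap H x y z (I ∷ O ∷ O ∷ u) ≡ x ⊕ φ H u
  coordinateMap-x+H u = solve 2 (λ h p → h ⊞ p ⊞ id ⊞ id ⊜ p ⊞ h) refl (φ H u) x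

  coordinateMap-y+H : ∀ u → coordinateMap H x y z (O ∷ I ∷ O ∷ u) ≡ y ⊕ φ H u
  coordinateMap-y+H u = solve 2 (λ h p → h ⊞ id ⊞ p ⊞ id ⊜ p ⊞ h) refl (φ H u) y

  coordinateMap-z+H : ∀ u → coordinateMap H x y z (O ∷ O ∷ I ∷ u) ≡ z ⊕ φ H u
  coordinateMap-z+H u = solve 2 (λ h p → h ⊞ id ⊞ id ⊞ p ⊜ p ⊞ h) refl (φ H u) z

  coordinateMap-x+y+z : coordinateMap H x y z (I ∷ I ∷ I ∷ 𝟎) ≡ x ⊕ y ⊕ z
  coordinateMap-x+y+z = trans (cong (λ h → h ⊕ x ⊕ y ⊕ z) (φ-zero H))
                              (solve 3 (λ p q r → id ⊞ p ⊞ q ⊞ r ⊜ p ⊞ q ⊞ r) refl x y z)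

record TripodCoordinates (k : ℕ) (M : Matroid n) : Set₁ where
  field
    dim         : ℕ
    base        : Matroid dim
    base-tripod : IsTripod k base
    ψ           : Flat n (3 + dim)
    E-ψ         : ∀ v → E M (φ ψ v) ⇔ TripodGround (E base) v

tripod-coordinates : ∀ k {n} {M : Matroid n} → IsTripod (suc k) M → TripodCoordinates k M
tripod-coordinates k {n} {M} (d , d+3≡n , H , x , y , z , _ , _ , _ , spans , ground , tripod) =
  record { dim = d ; base = restrict M H ; base-tripod = tripod ; ψ = ψ
         ; E-ψ = λ v → mk⇔ (to-ground v) from-ground }
  where
  open CoordinateMap H x y z

  ψ : Flat n (3 + d)
  ψ = coordinateFlat H x y z d+3≡n spans

  P : V d → Set
  P = E (restrict M H)

  located : ∀ {w v} → φ ψ w ≡ φ ψ v → TripodGround P w → TripodGround P v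
  located eq = subst (TripodGround P) (φ-inj ψ _ _ eq)

  to-ground : ∀ v → E M (φ ψ v) → TripodGround P v
  to-ground v e with to (ground (φ ψ v)) e
  ... | inj₁ ((u , φu≡) , _) =
    located (trans (coordinateMap-H u) φu≡) (in-H (subst (E M) (sym φu≡) e))
  ... | inj₂ (inj₁ (u , u∈E , inj₁ eq))        = located (trans (coordinateMap-x+H u) (sym eq)) (x+H u∈E)
  ... | inj₂ (inj₁ (u , u∈E , inj₂ (inj₁ eq))) = located (trans (coordinateMap-y+H u) (sym eq)) (y+H u∈E)
  ... | inj₂ (inj₁ (u , u∈E , inj₂ (inj₂ eq))) = located (trans (coordinateMap-z+H u) (sym eq)) (z+H u∈E)
  ... | inj₂ (inj₂ eq)                         = located (trans coordinateMap-x+y+z (sym eq)) x+y+z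

  from-ground : ∀ {v} → TripodGround P v → E M (φ ψ v)
  from-ground (in-H {u} e) = subst (E M) (sym (coordinateMap-H u)) e
  from-ground (x+H {u} e)  = subst (E M) (sym (coordinateMap-x+H u))
                             (from (ground _) (inj₂ (inj₁ (u , e , inj₁ refl))))
  from-ground (y+H {u} e)  = subst (E M) (sym (coordinateMap-y+H u))
                             (from (ground _) (inj₂ (inj₁ (u , e , inj₂ (inj₁ refl)))))
  from-ground (z+H {u} e)  = subst (E M) (sym (coordinateMap-z+H u))
                             (from (ground _) (inj₂ (inj₁ (u , e , inj₂ (inj₂ refl)))))
  from-ground x+y+z        = subst (E M) (sym coordinateMap-x+y+z)
                             (from (ground _) (inj₂ (inj₂ refl)))

tripod-nonempty : ∀ k {n} {M : Matroid n} → IsTripod (suc k) M → Σ (V n) (E M)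
tripod-nonempty _ (_ , _ , _ , x , y , z , _ , _ , _ , _ , ground , _) =
  x ⊕ y ⊕ z , from (ground _) (inj₂ (inj₂ refl))

tripod-dimension : ∀ k (M : Matroid n) → IsTripod k M → n ≡ 3 * k + 1
tripod-dimension zero    M (n≡1 , _) = n≡1
tripod-dimension {n} (suc k) M (d , d+3≡n , H , _ , _ , _ , _ , _ , _ , _ , _ , tripod) = begin
  n              ≡⟨ sym d+3≡n ⟩
  d + 3          ≡⟨ cong (_+ 3) (tripod-dimension k (restrict M H) tripod) ⟩
  3 * k + 1 + 3  ≡⟨ +-comm (3 * k + 1) 3 ⟩
  3 + 3 * k + 1  ≡⟨ cong (_+ 1) (sym (*-suc 3 k)) ⟩
  3 * suc k + 1  ∎
  where open ≡-Reasoning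

-- The flats F_k

V₁-nonzero : (p : V 1) → ¬ p ≡ 𝟎 → p ≡ I ∷ []
V₁-nonzero (I ∷ []) _   = refl
V₁-nonzero (O ∷ []) p≢𝟎 = ⊥-elim (p≢𝟎 refl)

T₀-ground : (M : Matroid 1) → IsTripod 0 M → ∀ u → E M u ⇔ u ≡ I ∷ []
T₀-ground M (_ , p , E⇔p) =
  subst (λ q → ∀ u → E M u ⇔ u ≡ q) (V₁-nonzero p (E-nz M p (from (E⇔p p) refl))) E⇔p

module T₁ (N : Matroid 4) (E-N : ∀ v → E N v ⇔ TripodGround (_≡ I ∷ []) v) where

  h x+h y+h z+h xyz : V 4
  h   = O ∷ O ∷ O ∷ I ∷ []
  x+h = I ∷ O ∷ O ∷ I ∷ []
  y+h = O ∷ I ∷ O ∷ I ∷ []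
  z+h = O ∷ O ∷ I ∷ I ∷ []
  xyz = I ∷ I ∷ I ∷ O ∷ []

  Five : V 4 → Set
  Five v = v ≡ h ⊎ v ≡ x+h ⊎ v ≡ y+h ⊎ v ≡ z+h ⊎ v ≡ xyz

  ground : ∀ v → E N v ⇔ Five v
  ground v = ⇔.trans (E-N v) (mk⇔ to-five from-five)
    where
    to-five : ∀ {v} → TripodGround (_≡ I ∷ []) v → Five v
    to-five (in-H refl) = inj₁ refl
    to-five (x+H refl)  = inj₂ (inj₁ refl)
    to-five (y+H refl)  = inj₂ (inj₂ (inj₁ refl))
    to-five (z+H refl)  = inj₂ (inj₂ (inj₂ (inj₁ refl)))
    to-five x+y+z       = inj₂ (inj₂ (inj₂ (inj₂ refl)))

    from-five : ∀ {v} → Five v → TripodGround (_≡ I ∷ []) v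
    from-five (inj₁ refl)                      = in-H refl
    from-five (inj₂ (inj₁ refl))               = x+H refl
    from-five (inj₂ (inj₂ (inj₁ refl)))        = y+H refl
    from-five (inj₂ (inj₂ (inj₂ (inj₁ refl)))) = z+H refl
    from-five (inj₂ (inj₂ (inj₂ (inj₂ refl)))) = x+y+z

  h∈E : E N h
  h∈E = from (ground h) (inj₁ refl)
  x+h∈E : E N x+h
  x+h∈E = from (ground x+h) (inj₂ (inj₁ refl))
  y+h∈E : E N y+h
  y+h∈E = from (ground y+h) (inj₂ (inj₂ (inj₁ refl)))
  z+h∈E : E N z+h
  z+h∈E = from (ground z+h) (inj₂ (inj₂ (inj₂ (inj₁ refl))))
  xyz∈E : E N xyz
  xyz∈E = from (ground xyz) (inj₂ (inj₂ (inj₂ (inj₂ refl))))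

  covers : Covers N idᶠ
  covers (O ∷ O ∷ O ∷ O ∷ []) v≢𝟎 = ⊥-elim (v≢𝟎 refl)
  covers (O ∷ O ∷ O ∷ I ∷ []) _ = inj₁ h∈E
  covers (O ∷ O ∷ I ∷ O ∷ []) _ = inj₂ (h , z+h , h∈E , z+h∈E , refl)
  covers (O ∷ O ∷ I ∷ I ∷ []) _ = inj₁ z+h∈E
  covers (O ∷ I ∷ O ∷ O ∷ []) _ = inj₂ (h , y+h , h∈E , y+h∈E , refl)
  covers (O ∷ I ∷ O ∷ I ∷ []) _ = inj₁ y+h∈E
  covers (O ∷ I ∷ I ∷ O ∷ []) _ = inj₂ (y+h , z+h , y+h∈E , z+h∈E , refl)
  covers (O ∷ I ∷ I ∷ I ∷ []) _ = inj₂ (x+h , xyz , x+h∈E , xyz∈E , refl)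
  covers (I ∷ O ∷ O ∷ O ∷ []) _ = inj₂ (h , x+h , h∈E , x+h∈E , refl)
  covers (I ∷ O ∷ O ∷ I ∷ []) _ = inj₁ x+h∈E
  covers (I ∷ O ∷ I ∷ O ∷ []) _ = inj₂ (x+h , z+h , x+h∈E , z+h∈E , refl)
  covers (I ∷ O ∷ I ∷ I ∷ []) _ = inj₂ (y+h , xyz , y+h∈E , xyz∈E , refl)
  covers (I ∷ I ∷ O ∷ O ∷ []) _ = inj₂ (x+h , y+h , x+h∈E , y+h∈E , refl)
  covers (I ∷ I ∷ O ∷ I ∷ []) _ = inj₂ (z+h , xyz , z+h∈E , xyz∈E , refl)
  covers (I ∷ I ∷ I ∷ O ∷ []) _ = inj₁ xyz∈E
  covers (I ∷ I ∷ I ∷ I ∷ []) _ = inj₂ (h , xyz , h∈E , xyz∈E , refl)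

  spans : ∀ v → InSpan (E N) v
  spans = covers-span {M = N} covers

  distinct : Distinct5 h x+h y+h z+h xyz
  distinct = (λ ()) , (λ ()) , (λ ()) , (λ ()) , (λ ()) , (λ ()) , (λ ()) , (λ ()) , (λ ()) , (λ ())

  isC5 : IsC5 N
  isC5 = refl , h , x+h , y+h , z+h , xyz , distinct , ground , refl , spans

C5Flat-T₁ : (M' : Matroid d) → IsTripod 0 M' → (N : Matroid (3 + d)) →
            (∀ v → E N v ⇔ TripodGround (E M') v) → C5Flat 4 N
C5Flat-T₁ M' t@(refl , _) N E-N =
  idᶠ , (4 , idᶠ , (λ v _ → v , refl) , spans , isC5) , covers
  where open T₁ N (λ v → ⇔.trans (E-N v) (TripodGround-resp (T₀-ground M' t) v))

-- F ⊕ ⟨x + y, y + z⟩ in the coordinates of tripod-coordinates: s (x + y) + t (y + z) + F w.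
evenExtension : Flat d m → Flat (3 + d) (2 + m)
evenExtension {d} {m} F = record { φ = embed ; φ-add = embed-linear ; φ-inj = embed-injective }
  where
  open CommutativeSemigroupProperties (CommutativeRing.+-commutativeSemigroup xor-∧-commutativeRing)
    using (interchange)

  embed : V (2 + m) → V (3 + d)
  embed (s ∷ t ∷ w) = s ∷ (s xor t) ∷ t ∷ φ F w

  embed-linear : Linear embed
  embed-linear (s ∷ t ∷ w) (s' ∷ t' ∷ w') =
    cong₂ (λ b u → (s xor s') ∷ b ∷ (t xor t') ∷ u) (interchange s s' t t') (φ-add F w w')

  embed-injective : ∀ u u' → embed u ≡ embed u' → u ≡ u'
  embed-injective (s ∷ t ∷ w) (s' ∷ t' ∷ w') eq with ∷-injective eq
  ... | refl , eq₁ with ∷-injective (∷-injectiveʳ eq₁)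
  ... | refl , eq₂ = cong (λ w → s ∷ t ∷ w) (φ-inj F w w' eq₂)

private
  x̂ ŷ ẑ x̂ŷẑ : V 3
  x̂ = I ∷ O ∷ O ∷ []
  ŷ = O ∷ I ∷ O ∷ []
  ẑ = O ∷ O ∷ I ∷ []
  x̂ŷẑ = I ∷ I ∷ I ∷ []

module _ (M' : Matroid d) (N : Matroid (3 + d)) (E-N : ∀ v → E N v ⇔ TripodGround (E M') v) where

  private
    ⟨_⟩ : ∀ {v} → TripodGround (E M') v → E N v
    ⟨_⟩ = from (E-N _)

  evenExtension-IsC5t : (F : Flat d m) → IsC5t m (restrict M' F) →
                        IsC5t (2 + m) (restrict N (evenExtension F))
  evenExtension-IsC5t {m} F c5 =
    IsC5t-lift {M = N′} pad E⊆pad (IsC5t-resp {A = restrict M' F} {restrict N′ pad} E-on-F c5)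
    where
    N′ : Matroid (2 + m)
    N′ = restrict N (evenExtension F)

    pad : Flat (2 + m) m
    pad = record
      { φ = λ w → O ∷ O ∷ w ; φ-add = λ _ _ → refl ; φ-inj = λ _ _ → ∷-injectiveʳ ∘ ∷-injectiveʳ }

    E⊆pad : ∀ v → E N′ v → v ∈F pad
    E⊆pad (s ∷ t ∷ w) e with even-weight s t (to (E-N _) e)
    ... | refl , refl = w , refl

    E-on-F : ∀ w → E M' (φ F w) ⇔ E N (O ∷ O ∷ O ∷ φ F w)
    E-on-F w = mk⇔ (⟨_⟩ ∘ in-H) (in-H⁻¹ ∘ to (E-N _))

  pair-pattern-covered : Σ (V d) (E M') → (F : Flat d m) → Covers M' F →
    ∀ (πᵢ πⱼ πₗ : V 3) → x̂ŷẑ ⊕ πₗ ≡ πᵢ ⊕ πⱼ →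
    (∀ {u} → E M' u → TripodGround (E M') (πᵢ ++ᵥ u)) →
    (∀ {u} → E M' u → TripodGround (E M') (πⱼ ++ᵥ u)) →
    (∀ {u} → E M' u → TripodGround (E M') (πₗ ++ᵥ u)) →
    ∀ w → E N ((πᵢ ⊕ πⱼ) ++ᵥ φ F w) ⊎ PairSum (E N) ((πᵢ ⊕ πⱼ) ++ᵥ φ F w)
  pair-pattern-covered (e , e∈E) F covers πᵢ πⱼ πₗ πₗ-sum Eᵢ Eⱼ Eₗ w
    with ≡-dec _≟ᵇ_ w 𝟎
  ... | yes refl = inj₂ (πᵢ ++ᵥ e , πⱼ ++ᵥ e , ⟨ Eᵢ e∈E ⟩ , ⟨ Eⱼ e∈E ⟩ , (begin
    (πᵢ ⊕ πⱼ) ++ᵥ φ F 𝟎      ≡⟨ cong ((πᵢ ⊕ πⱼ) ++ᵥ_) (trans (φ-zero F) (sym (⊕-self e))) ⟩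
    (πᵢ ⊕ πⱼ) ++ᵥ (e ⊕ e)    ≡⟨ sym (zipWith-++ _xor_ πᵢ e πⱼ e) ⟩
    (πᵢ ++ᵥ e) ⊕ (πⱼ ++ᵥ e)  ∎))
    where open ≡-Reasoning
  ... | no w≢𝟎 with covers w w≢𝟎
  ... | inj₁ Fw∈E = inj₂ (x̂ŷẑ ++ᵥ 𝟎 , πₗ ++ᵥ φ F w , ⟨ x+y+z ⟩ , ⟨ Eₗ Fw∈E ⟩ , (begin
    (πᵢ ⊕ πⱼ) ++ᵥ φ F w           ≡⟨ cong₂ _++ᵥ_ (sym πₗ-sum) (sym (⊕-identityˡ (φ F w))) ⟩
    (x̂ŷẑ ⊕ πₗ) ++ᵥ (𝟎 ⊕ φ F w)    ≡⟨ sym (zipWith-++ _xor_ x̂ŷẑ 𝟎 πₗ (φ F w)) ⟩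
    (x̂ŷẑ ++ᵥ 𝟎) ⊕ (πₗ ++ᵥ φ F w)  ∎))
    where open ≡-Reasoning
  ... | inj₂ (a , b , a∈E , b∈E , Fw≡a⊕b) =
    inj₂ (πᵢ ++ᵥ a , πⱼ ++ᵥ b , ⟨ Eᵢ a∈E ⟩ , ⟨ Eⱼ b∈E ⟩ ,
          trans (cong ((πᵢ ⊕ πⱼ) ++ᵥ_) Fw≡a⊕b) (sym (zipWith-++ _xor_ πᵢ a πⱼ b)))

  evenExtension-Covers : Σ (V d) (E M') → (F : Flat d m) → Covers M' F → Covers N (evenExtension F)
  evenExtension-Covers _ F covers (O ∷ O ∷ w) v≢𝟎
    with covers w (v≢𝟎 ∘ cong (λ u → O ∷ O ∷ u))
  ... | inj₁ Fw∈E = inj₁ ⟨ in-H Fw∈E ⟩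
  ... | inj₂ (a , b , a∈E , b∈E , Fw≡a⊕b) =
    inj₂ (O ∷ O ∷ O ∷ a , O ∷ O ∷ O ∷ b , ⟨ in-H a∈E ⟩ , ⟨ in-H b∈E ⟩ ,
          cong (λ u → O ∷ O ∷ O ∷ u) Fw≡a⊕b)
  evenExtension-Covers nonempty F covers (I ∷ O ∷ w) _ =
    pair-pattern-covered nonempty F covers x̂ ŷ ẑ refl x+H y+H z+H w
  evenExtension-Covers nonempty F covers (O ∷ I ∷ w) _ =
    pair-pattern-covered nonempty F covers ŷ ẑ x̂ refl y+H z+H x+H w
  evenExtension-Covers nonempty F covers (I ∷ I ∷ w) _ =
    pair-pattern-covered nonempty F covers x̂ ẑ ŷ refl x+H z+H y+H w

  C5Flat-extend : Σ (V d) (E M') → C5Flat m M' → C5Flat (2 + m) N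
  C5Flat-extend nonempty (F , c5 , covers) =
    evenExtension F , evenExtension-IsC5t F c5 , evenExtension-Covers nonempty F covers

tripod-C5Flat : ∀ k {n} {M : Matroid n} → IsTripod (suc k) M → C5Flat (2 * suc k + 2) M
tripod-C5Flat zero {M = M} t = restrict-C5Flat {M = M} ψ (C5Flat-T₁ base base-tripod (restrict M ψ) E-ψ)
  where open TripodCoordinates (tripod-coordinates zero {M = M} t)
tripod-C5Flat (suc k) {M = M} t =
  restrict-C5Flat {M = M} ψ (subst (λ m → C5Flat m (restrict M ψ)) (cong (_+ 2) (sym (*-suc 2 (suc k))))
    (C5Flat-extend base (restrict M ψ) E-ψ (tripod-nonempty k {M = base} base-tripod)
                                           (tripod-C5Flat k {M = base} base-tripod)))
  where open TripodCoordinates (tripod-coordinates (suc k) {M = M} t)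

lemma4p1 : (k n : ℕ) (M : Matroid n) → IsTripod k M →
    (n ≡ 3 * k + 1) ×
    (k ≥ 1 →
      Σ (Flat n (2 * k + 2)) λ F →
        IsC5t (2 * k + 2) (restrict M F) ×
        (∀ u → ¬ (u ≡ 𝟎) →
          E M (φ F u) ⊎ (Σ (V n) λ a → Σ (V n) λ b → E M a × E M b × φ F u ≡ a ⊕ b)))
lemma4p1 zero    n M t = tripod-dimension zero M t , λ ()
lemma4p1 (suc k) n M t = tripod-dimension (suc k) M t , λ _ → tripod-C5Flat k {M = M} t
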